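{- For every positive integer $k$, $n(2k)\geq 8k+10$ and $n(2k+1)\geq 8k+9$.
   Context: For a positive integer $N$, $[1,N]=\{1,\dots,N\}$. A $3$-coloring of $[1,N]$ is a function $\chi:[1,N]\to\{1,2,3\}$; it is exact if all three colors are used. For a positive integer $b$, a solution to $x+y+b=z$ in $[1,N]$ is a triple $(x,y,z)$ with $x,y,z\in[1,N]$ and $x+y+b=z$; it is monochromatic if $\chi(x)=\chi(y)=\chi(z)$ and rainbow if $\chi(x),\chi(y),\chi(z)$ are pairwise distinct. $n(b)$ denotes the minimum integer $N$ such that every exact $3$-coloring of $[1,N]$ admits either a monochromatic or a rainbow solution to $x+y+b=z$. -}

module Defs where

open import Data.Nat using (ℕ; _+_; _*_; _≤_; _<_)
open import Data.Fin using (Fin)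
open import Data.Product using (_×_; ∃-syntax)
open import Data.Sum using (_⊎_)
open import Relation.Binary.PropositionalEquality using (_≡_; _≢_)
open import Relation.Nullary using (¬_)

InRange : ℕ → ℕ → Set
InRange N x = 1 ≤ x × x ≤ N

-- A 3-coloring of [1,N]: a map into Fin 3 (values outside [1,N] are irrelevant).
Coloring : Set
Coloring = ℕ → Fin 3

Exact : ℕ → Coloring → Set
Exact N χ = (c : Fin 3) → ∃[ x ] (InRange N x × χ x ≡ c)

IsSolution : ℕ → ℕ → ℕ → ℕ → ℕ → Set
IsSolution N b x y z = InRange N x × InRange N y × InRange N z × x + y + b ≡ z

Monochromatic : Coloring → ℕ → ℕ → ℕ → Set
Monochromatic χ x y z = χ x ≡ χ y × χ y ≡ χ z

Rainbow : Coloring → ℕ → ℕ → ℕ → Set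
Rainbow χ x y z = χ x ≢ χ y × χ y ≢ χ z × χ x ≢ χ z

EveryExactHasSol : ℕ → ℕ → Set
EveryExactHasSol b N =
  (χ : Coloring) → Exact N χ →
  ∃[ x ] ∃[ y ] ∃[ z ] (IsSolution N b x y z × (Monochromatic χ x y z ⊎ Rainbow χ x y z))

-- n(b) ≥ M, where n(b) is the least N ≥ 3 with EveryExactHasSol b N
-- (for N ≤ 2 there are no exact 3-colorings, so those N are excluded).
nLowerBound : ℕ → ℕ → Set
nLowerBound b M = (N : ℕ) → 3 ≤ N → N < M → ¬ EveryExactHasSol b N

-- Give colour 0 to every number whose parity differs from that of b. Since
-- x + y + b = z forces an even number of x, y, z to have the wrong parity, no
-- solution is rainbow or monochromatic in colour 0, so it suffices to 2-colour
-- the numbers of the parity of b without monochromatic solutions. With m the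
-- least positive number of that parity and L = 2m + b, the interval [L, 2L + b)
-- and its complement do this up to N < 2L + 2b + m, which is 8k + 10 for b = 2k
-- and 8k + 9 for b = 2k + 1. For N < 4 + b an ad hoc colouring works.

module Submission where

open import Defs
open import Data.Bool using (Bool; true; false)
open import Data.Fin using (Fin; zero; suc)
open import Data.Nat using (ℕ; suc; _+_; _*_; _≤_; _<_; z≤n; s≤s; _≤?_; _<?_; parity)
open import Data.Nat.Properties
open import Data.Nat.Tactic.RingSolver using (solve-∀)
open import Data.Parity using (Parity; 0ℙ; 1ℙ; _⁻¹) renaming (_+_ to _+ℙ_)
open import Data.Parity.Properties using (+-homo-+; *-homo-*)
open import Data.Product using (_×_; _,_)
open import Data.Sum using (_⊎_; inj₁; inj₂)
open import Data.Empty using (⊥-elim)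
open import Function using (_∘_; case_of_)
open import Relation.Binary.PropositionalEquality
open import Relation.Nullary using (¬_; yes; no; does; _×-dec_)
open import Relation.Nullary.Decidable using (dec-true; dec-false)
open import Relation.Unary using (Pred; Decidable)

MonoOrRainbow : {A : Set} → A → A → A → Set
MonoOrRainbow a b c = (a ≡ b × b ≡ c) ⊎ (a ≢ b × b ≢ c × a ≢ c)

¬rainbow : {A : Set} {a b c : A} → a ≡ b ⊎ b ≡ c ⊎ a ≡ c → ¬ (a ≢ b × b ≢ c × a ≢ c)
¬rainbow (inj₁ a≡b)        (a≢b , _ , _) = a≢b a≡b
¬rainbow (inj₂ (inj₁ b≡c)) (_ , b≢c , _) = b≢c b≡c
¬rainbow (inj₂ (inj₂ a≡c)) (_ , _ , a≢c) = a≢c a≡c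

¬mono : {A : Set} {a b c : A} → a ≢ b ⊎ b ≢ c ⊎ a ≢ c → ¬ (a ≡ b × b ≡ c)
¬mono (inj₁ a≢b)        (a≡b , _)   = a≢b a≡b
¬mono (inj₂ (inj₁ b≢c)) (_ , b≡c)   = b≢c b≡c
¬mono (inj₂ (inj₂ a≢c)) (a≡b , b≡c) = a≢c (trans a≡b b≡c)

¬monoOrRainbow : {A : Set} {a b c : A} →
  a ≡ b ⊎ b ≡ c ⊎ a ≡ c → a ≢ b ⊎ b ≢ c ⊎ a ≢ c → ¬ MonoOrRainbow a b c
¬monoOrRainbow _  neq (inj₁ mono)    = ¬mono neq mono
¬monoOrRainbow eq _   (inj₂ rainbow) = ¬rainbow eq rainbow

Bool-pigeonhole : (a b c : Bool) → a ≡ b ⊎ b ≡ c ⊎ a ≡ c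
Bool-pigeonhole false false _     = inj₁ refl
Bool-pigeonhole true  true  _     = inj₁ refl
Bool-pigeonhole false true  false = inj₂ (inj₂ refl)
Bool-pigeonhole false true  true  = inj₂ (inj₁ refl)
Bool-pigeonhole true  false false = inj₂ (inj₁ refl)
Bool-pigeonhole true  false true  = inj₂ (inj₂ refl)

relativeParity : ℕ → ℕ → Parity
relativeParity b x = parity (x + b)

relativeParity-solution : ∀ b x y {z} → x + y + b ≡ z →
  relativeParity b z ≡ relativeParity b x +ℙ relativeParity b y
relativeParity-solution b x y refl = begin
  parity (x + y + b + b)       ≡⟨ cong parity (regroup x y b) ⟩
  parity ((x + b) + (y + b))   ≡⟨ +-homo-+ (x + b) (y + b) ⟩
  parity (x + b) +ℙ parity (y + b) ∎
  where
  open ≡-Reasoning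
  regroup : ∀ x y b → x + y + b + b ≡ (x + b) + (y + b)
  regroup = solve-∀

parity-double : ∀ n → parity (2 * n) ≡ 0ℙ
parity-double n = *-homo-* 2 n

onColour : Bool → Fin 3
onColour true  = suc zero
onColour false = suc (suc zero)

onColour-injective : ∀ {i j} → onColour i ≡ onColour j → i ≡ j
onColour-injective {true}  {true}  _ = refl
onColour-injective {false} {false} _ = refl

zero≢onColour : ∀ i → zero ≢ onColour i
zero≢onColour true  ()
zero≢onColour false ()

splitColour : Parity → Bool → Fin 3
splitColour 1ℙ _ = zero
splitColour 0ℙ i = onColour i

splitColour-monoOrRainbow : ∀ p q {r} i j k → r ≡ p +ℙ q →
  MonoOrRainbow (splitColour p i) (splitColour q j) (splitColour r k) →
  p ≡ 0ℙ × q ≡ 0ℙ × i ≡ j × j ≡ k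
splitColour-monoOrRainbow 1ℙ 1ℙ _ _ k refl =
  ⊥-elim ∘ ¬monoOrRainbow (inj₁ refl) (inj₂ (inj₁ (zero≢onColour k)))
splitColour-monoOrRainbow 1ℙ 0ℙ _ j _ refl =
  ⊥-elim ∘ ¬monoOrRainbow (inj₂ (inj₂ refl)) (inj₁ (zero≢onColour j))
splitColour-monoOrRainbow 0ℙ 1ℙ i _ _ refl =
  ⊥-elim ∘ ¬monoOrRainbow (inj₂ (inj₁ refl)) (inj₁ (zero≢onColour i ∘ sym))
splitColour-monoOrRainbow 0ℙ 0ℙ i j k refl (inj₁ (ij , jk)) =
  refl , refl , onColour-injective ij , onColour-injective jk
splitColour-monoOrRainbow 0ℙ 0ℙ i j k refl (inj₂ distinct) =
  ⊥-elim (¬rainbow (pigeonhole (Bool-pigeonhole i j k)) distinct)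
  where
  pigeonhole : i ≡ j ⊎ j ≡ k ⊎ i ≡ k →
    onColour i ≡ onColour j ⊎ onColour j ≡ onColour k ⊎ onColour i ≡ onColour k
  pigeonhole (inj₁ e)        = inj₁ (cong onColour e)
  pigeonhole (inj₂ (inj₁ e)) = inj₂ (inj₁ (cong onColour e))
  pigeonhole (inj₂ (inj₂ e)) = inj₂ (inj₂ (cong onColour e))

-- [L, 2L + b) is the longest interval starting at L that contains no solution.

Block : ℕ → ℕ → ℕ → Set
Block L b x = L ≤ x × x < 2 * L + b

block? : ∀ L b → Decidable (Block L b)
block? L b x = L ≤? x ×-dec x <? 2 * L + b

2*n≡n+n : ∀ n → 2 * n ≡ n + n
2*n≡n+n n = cong (n +_) (+-identityʳ n)

¬Block⇒below⊎above : ∀ {L b x} → ¬ Block L b x → x < L ⊎ 2 * L + b ≤ x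
¬Block⇒below⊎above {L} {b} {x} ¬block with L ≤? x
... | no  L≰x = inj₁ (≰⇒> L≰x)
... | yes L≤x = inj₂ (≮⇒≥ (λ x<2L+b → ¬block (L≤x , x<2L+b)))

Block-sum∉Block : ∀ {L b x y z} → Block L b x → Block L b y → x + y + b ≡ z → ¬ Block L b z
Block-sum∉Block {L} {b} {x} {y} (L≤x , _) (L≤y , _) refl (_ , z<2L+b) = <⇒≱ z<2L+b (begin
  2 * L + b  ≡⟨ cong (_+ b) (2*n≡n+n L) ⟩
  L + L + b  ≤⟨ +-monoˡ-≤ b (+-mono-≤ L≤x L≤y) ⟩
  x + y + b  ∎)
  where open ≤-Reasoning

nonBlock-sum∈Block : ∀ {m L b x y z} → L ≤ 2 * m + b → m ≤ x → m ≤ y → x + y + b ≡ z →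
  z < 2 * L + b + m + b → ¬ Block L b x → ¬ Block L b y → Block L b z
nonBlock-sum∈Block {m} {L} {b} {x} {y} L≤2m+b m≤x m≤y refl z<bound ¬Bx ¬By
  with ¬Block⇒below⊎above ¬Bx | ¬Block⇒below⊎above ¬By
... | inj₂ x-above | _ = ⊥-elim (<⇒≱ z<bound (+-monoˡ-≤ b (+-mono-≤ x-above m≤y)))
... | inj₁ _ | inj₂ y-above =
  ⊥-elim (<⇒≱ z<bound (+-monoˡ-≤ b (subst (_≤ x + y) (+-comm m _) (+-mono-≤ m≤x y-above))))
... | inj₁ x<L | inj₁ y<L = L≤z , z<2L+b
  where
  open ≤-Reasoning
  L≤z : L ≤ x + y + b
  L≤z = begin
    L          ≤⟨ L≤2m+b ⟩
    2 * m + b  ≡⟨ cong (_+ b) (2*n≡n+n m) ⟩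
    m + m + b  ≤⟨ +-monoˡ-≤ b (+-mono-≤ m≤x m≤y) ⟩
    x + y + b  ∎
  z<2L+b : x + y + b < 2 * L + b
  z<2L+b = begin-strict
    x + y + b  <⟨ +-monoˡ-< b (+-mono-< x<L y<L) ⟩
    L + L + b  ≡⟨ cong (_+ b) (2*n≡n+n L) ⟨
    2 * L + b  ∎

¬everyExactHasSol : ∀ {b N} (χ : Coloring) → Exact N χ →
  (∀ {x y z} → IsSolution N b x y z → ¬ MonoOrRainbow (χ x) (χ y) (χ z)) →
  ¬ EveryExactHasSol b N
¬everyExactHasSol χ exact avoids everyHasSol with everyHasSol χ exact
... | _ , _ , _ , solution , monoOrRainbow = avoids solution monoOrRainbow

splitColouring : ∀ {ℓ} {P : Pred ℕ ℓ} → ℕ → Decidable P → Coloring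
splitColouring b P? x = splitColour (relativeParity b x) (does (P? x))

does-uniform : ∀ {ℓ} {P : Pred ℕ ℓ} (P? : Decidable P) {x y z} →
  does (P? x) ≡ does (P? y) → does (P? y) ≡ does (P? z) →
  (P x × P y × P z) ⊎ (¬ P x × ¬ P y × ¬ P z)
does-uniform P? {x} {y} {z} _ _ with P? x | P? y | P? z
does-uniform P? () _ | yes _  | no _   | _
does-uniform P? () _ | no _   | yes _  | _
does-uniform P? _ () | yes _  | yes _  | no _
does-uniform P? _ () | no _   | no _   | yes _
does-uniform P? _ _  | yes px | yes py | yes pz = inj₁ (px , py , pz)
does-uniform P? _ _  | no ¬px | no ¬py | no ¬pz = inj₂ (¬px , ¬py , ¬pz)

splitColouring-monoOrRainbow : ∀ {ℓ} {P : Pred ℕ ℓ} {b} (P? : Decidable P) {x y z} →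
  x + y + b ≡ z →
  let χ = splitColouring b P? in MonoOrRainbow (χ x) (χ y) (χ z) →
  relativeParity b x ≡ 0ℙ × relativeParity b y ≡ 0ℙ × ((P x × P y × P z) ⊎ (¬ P x × ¬ P y × ¬ P z))
splitColouring-monoOrRainbow {b = b} P? {x} {y} {z} solution monoOrRainbow
  with splitColour-monoOrRainbow (relativeParity b x) (relativeParity b y)
         (does (P? x)) (does (P? y)) (does (P? z)) (relativeParity-solution b x y solution) monoOrRainbow
... | x-aligned , y-aligned , i≡j , j≡k = x-aligned , y-aligned , does-uniform P? i≡j j≡k

n<2*n+b : ∀ {n} b → 1 ≤ n → n < 2 * n + b
n<2*n+b {n} b 1≤n = begin-strict
  n          <⟨ m<m+n n 1≤n ⟩
  n + n      ≡⟨ 2*n≡n+n n ⟨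
  2 * n      ≤⟨ m≤m+n (2 * n) b ⟩
  2 * n + b  ∎
  where open ≤-Reasoning

¬everyExactHasSol-block : ∀ {b m N} → 1 ≤ m → relativeParity b m ≡ 0ℙ →
  (∀ {x} → 1 ≤ x → relativeParity b x ≡ 0ℙ → m ≤ x) →
  2 * m + b ≤ N → N < 2 * (2 * m + b) + b + m + b → ¬ EveryExactHasSol b N
¬everyExactHasSol-block {b} {m} {N} 1≤m m-aligned least L≤N N<bound =
  ¬everyExactHasSol χ exact avoids
  where
  L : ℕ
  L = 2 * m + b

  χ : Coloring
  χ = splitColouring b (block? L b)

  m<L : m < L
  m<L = n<2*n+b b 1≤m

  1≤L : 1 ≤ L
  1≤L = ≤-trans 1≤m (<⇒≤ m<L)

  L-aligned : relativeParity b L ≡ 0ℙ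
  L-aligned = trans (cong parity (regroup m b)) (parity-double (m + b))
    where
    regroup : ∀ m b → 2 * m + b + b ≡ 2 * (m + b)
    regroup = solve-∀

  suc-m-misaligned : relativeParity b (suc m) ≡ 1ℙ
  suc-m-misaligned = trans (+-homo-+ 1 (m + b)) (cong _⁻¹ m-aligned)

  exact : Exact N χ
  exact zero = suc m , (s≤s z≤n , ≤-trans m<L L≤N) ,
    cong (λ p → splitColour p (does (block? L b (suc m)))) suc-m-misaligned
  exact (suc zero) = L , (1≤L , L≤N) ,
    cong₂ splitColour L-aligned (dec-true (block? L b L) (≤-refl , n<2*n+b b 1≤L))
  exact (suc (suc zero)) = m , (1≤m , ≤-trans (<⇒≤ m<L) L≤N) ,
    cong₂ splitColour m-aligned (dec-false (block? L b m) (λ (L≤m , _) → <⇒≱ m<L L≤m))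

  avoids : ∀ {x y z} → IsSolution N b x y z → ¬ MonoOrRainbow (χ x) (χ y) (χ z)
  avoids ((1≤x , _) , (1≤y , _) , (_ , z≤N) , solution) monoOrRainbow
    with splitColouring-monoOrRainbow (block? L b) solution monoOrRainbow
  ... | _ , _ , inj₁ (Bx , By , Bz) = Block-sum∉Block Bx By solution Bz
  ... | x-aligned , y-aligned , inj₂ (¬Bx , ¬By , ¬Bz) =
    ¬Bz (nonBlock-sum∈Block ≤-refl (least 1≤x x-aligned) (least 1≤y y-aligned) solution
           (≤-<-trans z≤N N<bound) ¬Bx ¬By)

-- A solution with z < 4 + b has x + y ≤ 3, so its colour triple is one of
-- (0,0,1), (0,1,1), (1,0,1) when b ≥ 2.

smallColouring : Coloring
smallColouring 1 = zero
smallColouring 3 = suc (suc zero)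
smallColouring _ = suc zero

smallColouring-≥4 : ∀ {z} → 4 ≤ z → smallColouring z ≡ suc zero
smallColouring-≥4 (s≤s (s≤s (s≤s (s≤s _)))) = refl

smallColouring-avoids : ∀ {x y z} → 1 ≤ x → 1 ≤ y → x + y < 4 → 4 ≤ z →
  ¬ MonoOrRainbow (smallColouring x) (smallColouring y) (smallColouring z)
smallColouring-avoids {1} {1} _ _ _ 4≤z rewrite smallColouring-≥4 4≤z =
  ¬monoOrRainbow (inj₁ refl) (inj₂ (inj₁ λ ()))
smallColouring-avoids {1} {2} _ _ _ 4≤z rewrite smallColouring-≥4 4≤z =
  ¬monoOrRainbow (inj₂ (inj₁ refl)) (inj₁ λ ())
smallColouring-avoids {2} {1} _ _ _ 4≤z rewrite smallColouring-≥4 4≤z =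
  ¬monoOrRainbow (inj₂ (inj₂ refl)) (inj₁ λ ())
smallColouring-avoids {1} {suc (suc (suc _))} _ _ (s≤s (s≤s (s≤s (s≤s ())))) _
smallColouring-avoids {2} {suc (suc _)} _ _ (s≤s (s≤s (s≤s (s≤s ())))) _
smallColouring-avoids {suc (suc (suc x))} {y} _ 1≤y (s≤s (s≤s (s≤s (s≤s x+y≤0)))) _ =
  ⊥-elim (<⇒≱ 1≤y (m+n≤o⇒n≤o x x+y≤0))

¬everyExactHasSol-small : ∀ {b N} → 2 ≤ b → 3 ≤ N → N < 4 + b → ¬ EveryExactHasSol b N
¬everyExactHasSol-small {b} {N} 2≤b 3≤N N<4+b = ¬everyExactHasSol smallColouring exact avoids
  where
  exact : Exact N smallColouring
  exact zero             = 1 , (s≤s z≤n , ≤-trans (s≤s z≤n) 3≤N) , refl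
  exact (suc zero)       = 2 , (s≤s z≤n , ≤-trans (s≤s (s≤s z≤n)) 3≤N) , refl
  exact (suc (suc zero)) = 3 , (s≤s z≤n , 3≤N) , refl

  avoids : ∀ {x y z} → IsSolution N b x y z →
    ¬ MonoOrRainbow (smallColouring x) (smallColouring y) (smallColouring z)
  avoids {x} {y} ((1≤x , _) , (1≤y , _) , (_ , z≤N) , refl) =
    smallColouring-avoids 1≤x 1≤y
      (+-cancelʳ-< b (x + y) 4 (≤-<-trans z≤N N<4+b))
      (≤-trans (+-monoʳ-≤ 2 2≤b) (+-monoˡ-≤ b (+-mono-≤ 1≤x 1≤y)))

nLowerBound-parity : ∀ {b m} → 2 ≤ b → 1 ≤ m → m ≤ 2 → relativeParity b m ≡ 0ℙ →
  (∀ {x} → 1 ≤ x → relativeParity b x ≡ 0ℙ → m ≤ x) →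
  nLowerBound b (2 * (2 * m + b) + b + m + b)
nLowerBound-parity {b} 2≤b 1≤m m≤2 m-aligned least N 3≤N N<bound with N <? 4 + b
... | yes N<4+b = ¬everyExactHasSol-small 2≤b 3≤N N<4+b
... | no  N≮4+b = ¬everyExactHasSol-block 1≤m m-aligned least
  (≤-trans (+-monoˡ-≤ b (*-monoʳ-≤ 2 m≤2)) (≮⇒≥ N≮4+b)) N<bound

lemma3p2 : (k : ℕ) → 1 ≤ k →
    nLowerBound (2 * k) (8 * k + 10) × nLowerBound (2 * k + 1) (8 * k + 9)
lemma3p2 k 1≤k =
  subst (nLowerBound (2 * k)) (bound-even k)
    (nLowerBound-parity 2≤2k (s≤s z≤n) ≤-refl (parity-double k) positive-even⇒≥2) ,
  subst (nLowerBound (2 * k + 1)) (bound-odd k)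
    (nLowerBound-parity (m≤n⇒m≤n+o 1 2≤2k) ≤-refl (s≤s z≤n) 1-aligned (λ 1≤x _ → 1≤x))
  where
  2≤2k : 2 ≤ 2 * k
  2≤2k = *-monoʳ-≤ 2 1≤k

  positive-even⇒≥2 : ∀ {x} → 1 ≤ x → relativeParity (2 * k) x ≡ 0ℙ → 2 ≤ x
  positive-even⇒≥2 {1} _ 1-even =
    case trans (sym (trans (+-homo-+ 1 (2 * k)) (cong _⁻¹ (parity-double k)))) 1-even of λ ()
  positive-even⇒≥2 {suc (suc _)} _ _ = s≤s (s≤s z≤n)

  1-aligned : relativeParity (2 * k + 1) 1 ≡ 0ℙ
  1-aligned = trans (cong parity (regroup k)) (parity-double (suc k))
    where
    regroup : ∀ k → 1 + (2 * k + 1) ≡ 2 * suc k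
    regroup = solve-∀

  bound-even : ∀ k → 2 * (2 * 2 + 2 * k) + 2 * k + 2 + 2 * k ≡ 8 * k + 10
  bound-even = solve-∀

  bound-odd : ∀ k → 2 * (2 * 1 + (2 * k + 1)) + (2 * k + 1) + 1 + (2 * k + 1) ≡ 8 * k + 9
  bound-odd = solve-∀
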